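{- For all integers $k,m,n$ with $n\ge1$, \[ \left|\frac{1}{n}\sum_{l=0}^{n-1}\zeta_n^{kl}\zeta_{2n}^{(n-l)lm}\right|^2=\frac{1}{n}\sum_{l=0}^{n-1}\zeta_n^{kl}\zeta_{2n}^{(n-l)lm}\,\delta^{(n)}_{ml,0}. \]
   Context: For a positive integer $N$, $\zeta_N=e^{2\pi i/N}$. For integers $a,b$, $\delta^{(n)}_{a,b}$ equals $1$ if $a\equiv b\pmod n$ and $0$ otherwise. -}

module Defs where

open import Level using (_⊔_)
open import Data.Nat as ℕ using (ℕ; zero; suc)
open import Data.Integer as ℤ using (ℤ; +_; _%ℕ_)
open import Data.Sum using (_⊎_)
open import Relation.Nullary using (¬_)
open import Algebra.Bundles using (CommutativeRing)

-- Reduction of an integer modulo a natural number d (result in [0,d)),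
-- with the convention e mod 0 = 0 (only used for d ≥ 1 below).
modN : ℤ → ℕ → ℕ
modN e zero    = 0
modN e (suc d) = e %ℕ suc d

module Cyclo {c ℓ} (R : CommutativeRing c ℓ) where
  open CommutativeRing R public

  pow : Carrier → ℕ → Carrier
  pow x zero    = 1#
  pow x (suc j) = x * pow x j

  nat : ℕ → Carrier
  nat zero    = 0#
  nat (suc j) = 1# + nat j

  sumTo : ℕ → (ℕ → Carrier) → Carrier
  sumTo zero    f = 0#
  sumTo (suc n) f = sumTo n f + f n

  IsPrimitiveRoot : ℕ → Carrier → Set ℓ
  IsPrimitiveRoot N ω =
    (pow ω N ≈ 1#) × (∀ j → 0 ℕ.< j → j ℕ.< N → ¬ (pow ω j ≈ 1#))
    where open import Data.Product using (_×_)

  -- integer power of an element ω with ω^N = 1 : ω^e := ω^(e mod N)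
  zpow : ℕ → Carrier → ℤ → Carrier
  zpow N ω e = pow ω (modN e N)

  NoZeroDivisors : Set (c ⊔ ℓ)
  NoZeroDivisors = ∀ x y → x * y ≈ 0# → (x ≈ 0#) ⊎ (y ≈ 0#)

  -- "complex conjugation": a ring endomorphism sending ω to ω⁻¹
  record IsConjugation (conj : Carrier → Carrier) (ω : Carrier) : Set (c ⊔ ℓ) where
    field
      conj-cong : ∀ {x y} → x ≈ y → conj x ≈ conj y
      conj-+    : ∀ x y → conj (x + y) ≈ conj x + conj y
      conj-*    : ∀ x y → conj (x * y) ≈ conj x * conj y
      conj-1    : conj 1# ≈ 1#
      conj-ω    : conj ω * ω ≈ 1#

  absSq : (Carrier → Carrier) → Carrier → Carrier
  absSq conj z = z * conj z

  delta : ℕ → ℤ → Carrier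
  delta n a with modN a n
  ... | zero  = 1#
  ... | suc _ = 0#

  -- With ω = ζ_{2n}: ζ_n^{kl} ζ_{2n}^{(n-l)lm} = ω^{2kl + (n-l)lm}
  summand : ℕ → Carrier → ℤ → ℤ → ℕ → Carrier
  summand n ω k m l =
    zpow (2 ℕ.* n) ω ((+ 2) ℤ.* k ℤ.* (+ l) ℤ.+ ((+ n) ℤ.- (+ l)) ℤ.* (+ l) ℤ.* m)

module Submission where

-- Let N = 2n and E(e) = ω^(e mod N), which is `zpow N ω`.  As ω^N = 1,
-- E turns sums of integers into products, is N-periodic, and the conjugation
-- sends E(e) to E(-e).  The summand is g(l) = E(F l) for the quadratic phase
-- F l = 2kl + (n-l)lm.  Since F(l+n) ≡ F l (mod N), g is n-periodic, so the
-- sum of g over any n consecutive indices is S = Σ_{l<n} g l.  Moreover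
-- F(d+b) - F b = F d - 2mdb, whence
--   S·conj S = Σ_b Σ_d g(d+b)·E(-F b) = Σ_d g d · Σ_b E(-2mdb).
-- The inner sum is the orthogonality relation Σ_{b<n} E(-2tb) = n·δ_n(t):
-- if n ∣ t every term is 1; otherwise z = E(-2t) satisfies zⁿ = 1 but z ≠ 1
-- (ω is primitive), and in a domain such a geometric sum vanishes.  Scaling
-- by invn² and using n·invn = 1 gives the theorem.

open import Defs
open import Data.Nat as ℕ using (ℕ; zero; suc; _≤_; z≤n; s≤s; NonZero)
import Data.Nat.Properties as ℕP
open import Data.Nat.DivMod using (m≡m%n+[m/n]*n; [m+kn]%n≡m%n; m<n⇒m%n≡m)
open import Data.Integer as ℤ using (ℤ; +_; -[1+_]; _%ℕ_; _/ℕ_)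
import Data.Integer.Properties as ℤP
open import Data.Integer.DivMod using (a≡a%ℕn+[a/ℕn]*n; n%ℕd<d)
open import Data.Integer.Tactic.RingSolver using (solve-∀)
import Relation.Binary.PropositionalEquality as P
open import Algebra.Bundles using (CommutativeRing)
open import Data.Maybe using (nothing)
open import Tactic.RingSolver.Core.AlmostCommutativeRing using (fromCommutativeRing)
open import Data.Product using (proj₁; proj₂)
open import Data.Sum using (inj₁; inj₂)
open import Data.Empty using (⊥-elim)
open import Relation.Nullary using (¬_)

module Remainders where
  open P using (_≡_; sym; trans; cong)
  open P.≡-Reasoning

  pos-affine : ∀ r j d → + (r ℕ.+ j ℕ.* d) ≡ + r ℤ.+ + j ℤ.* + d
  pos-affine r j d = trans (ℤP.pos-+ r (j ℕ.* d)) (cong (ℤ._+_ (+ r)) (ℤP.pos-* j d))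

  ℕ-remainder-unique : ∀ {d} .{{_ : NonZero d}} {r r'} j →
    r ℕ.< d → r' ℕ.< d → r' ≡ r ℕ.+ j ℕ.* d → r' ≡ r
  ℕ-remainder-unique {d} {r} {r'} j r<d r'<d eq = begin
    r'                    ≡⟨ sym (m<n⇒m%n≡m r'<d) ⟩
    r' ℕ.% d              ≡⟨ cong (ℕ._% d) eq ⟩
    (r ℕ.+ j ℕ.* d) ℕ.% d ≡⟨ [m+kn]%n≡m%n r j d ⟩
    r ℕ.% d               ≡⟨ m<n⇒m%n≡m r<d ⟩
    r                     ∎

  remainder-unique : ∀ {d} .{{_ : NonZero d}} {r r'} s →
    r ℕ.< d → r' ℕ.< d → + r' ≡ + r ℤ.+ s ℤ.* + d → r' ≡ r
  remainder-unique {d} {r} {r'} (+ j) r<d r'<d eq =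
    ℕ-remainder-unique j r<d r'<d (ℤP.+-injective (trans eq (sym (pos-affine r j d))))
  remainder-unique {d} {r} {r'} -[1+ j ] r<d r'<d eq =
    sym (ℕ-remainder-unique (suc j) r'<d r<d (ℤP.+-injective (trans eq' (sym (pos-affine r' (suc j) d)))))
    where
    undo : ∀ a s D → a ≡ (a ℤ.+ s ℤ.* D) ℤ.+ (ℤ.- s) ℤ.* D
    undo = solve-∀
    eq' : + r ≡ + r' ℤ.+ + suc j ℤ.* + d
    eq' = trans (undo (+ r) -[1+ j ] (+ d)) (cong (λ x → x ℤ.+ + suc j ℤ.* + d) (sym eq))

  %ℕ-periodic : ∀ d .{{_ : NonZero d}} e t → (e ℤ.+ t ℤ.* + d) %ℕ d ≡ e %ℕ d
  %ℕ-periodic d e t =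
    remainder-unique (q ℤ.+ t ℤ.- q') (n%ℕd<d e d) (n%ℕd<d e' d) decomposition
    where
    e' = e ℤ.+ t ℤ.* + d
    q  = e /ℕ d
    q' = e' /ℕ d
    cancel : ∀ x y D → x ≡ (x ℤ.+ y ℤ.* D) ℤ.- y ℤ.* D
    cancel = solve-∀
    regroup : ∀ x q t q' D → ((x ℤ.+ q ℤ.* D) ℤ.+ t ℤ.* D) ℤ.- q' ℤ.* D ≡ x ℤ.+ (q ℤ.+ t ℤ.- q') ℤ.* D
    regroup = solve-∀
    decomposition : + (e' %ℕ d) ≡ + (e %ℕ d) ℤ.+ (q ℤ.+ t ℤ.- q') ℤ.* + d
    decomposition = begin
      + (e' %ℕ d)                                        ≡⟨ cancel (+ (e' %ℕ d)) q' (+ d) ⟩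
      (+ (e' %ℕ d) ℤ.+ q' ℤ.* + d) ℤ.- q' ℤ.* + d        ≡⟨ cong (ℤ._- q' ℤ.* + d) (sym (a≡a%ℕn+[a/ℕn]*n e' d)) ⟩
      e' ℤ.- q' ℤ.* + d                                  ≡⟨ cong (λ x → (x ℤ.+ t ℤ.* + d) ℤ.- q' ℤ.* + d) (a≡a%ℕn+[a/ℕn]*n e d) ⟩
      ((+ (e %ℕ d) ℤ.+ q ℤ.* + d) ℤ.+ t ℤ.* + d) ℤ.- q' ℤ.* + d ≡⟨ regroup (+ (e %ℕ d)) q t q' (+ d) ⟩
      + (e %ℕ d) ℤ.+ (q ℤ.+ t ℤ.- q') ℤ.* + d            ∎

  %ℕ≡0⇒multiple : ∀ d .{{_ : NonZero d}} e → e %ℕ d ≡ 0 → e ≡ (e /ℕ d) ℤ.* + d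
  %ℕ≡0⇒multiple d e r≡0 = begin
    e                                 ≡⟨ a≡a%ℕn+[a/ℕn]*n e d ⟩
    + (e %ℕ d) ℤ.+ (e /ℕ d) ℤ.* + d   ≡⟨ cong (λ r → + r ℤ.+ (e /ℕ d) ℤ.* + d) r≡0 ⟩
    + 0 ℤ.+ (e /ℕ d) ℤ.* + d          ≡⟨ ℤP.+-identityˡ _ ⟩
    (e /ℕ d) ℤ.* + d                  ∎

  private instance
    double-nonZero : ∀ {d} .{{_ : NonZero d}} → NonZero (2 ℕ.* d)
    double-nonZero {d} = ℕP.m*n≢0 2 d

  half-multiple : ∀ d .{{_ : NonZero d}} t → (ℤ.- (+ 2 ℤ.* t)) %ℕ (2 ℕ.* d) ≡ 0 → t %ℕ d ≡ 0
  half-multiple d t r≡0 =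
    trans (cong (_%ℕ d) t≡sd) (trans (%ℕ-periodic d (+ 0) s) (m<n⇒m%n≡m (ℕ.>-nonZero⁻¹ d)))
    where
    q = (ℤ.- (+ 2 ℤ.* t)) /ℕ (2 ℕ.* d)
    s = ℤ.- q
    from-negated : ∀ t q d → ℤ.- (+ 2 ℤ.* t) ≡ q ℤ.* (+ 2 ℤ.* d) → + 2 ℤ.* t ≡ + 2 ℤ.* ((ℤ.- q) ℤ.* d)
    from-negated t q d eq = trans (double-negate t) (trans (cong ℤ.-_ eq) (scale q d))
      where
      double-negate : ∀ x → + 2 ℤ.* x ≡ ℤ.- (ℤ.- (+ 2 ℤ.* x))
      double-negate = solve-∀
      scale : ∀ q d → ℤ.- (q ℤ.* (+ 2 ℤ.* d)) ≡ + 2 ℤ.* ((ℤ.- q) ℤ.* d)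
      scale = solve-∀
    -2t≡q2d : ℤ.- (+ 2 ℤ.* t) ≡ q ℤ.* (+ 2 ℤ.* + d)
    -2t≡q2d = trans (%ℕ≡0⇒multiple (2 ℕ.* d) _ r≡0) (cong (q ℤ.*_) (ℤP.pos-* 2 d))
    t≡sd : t ≡ + 0 ℤ.+ s ℤ.* + d
    t≡sd = trans (ℤP.*-cancelˡ-≡ (+ 2) t (s ℤ.* + d) (from-negated t q (+ d) -2t≡q2d))
                 (sym (ℤP.+-identityˡ _))

open Remainders

-- The phase of the summand: summand n ω k m l = zpow (2n) ω (phase k m (+ n) (+ l)).
module Phase where
  open P using (_≡_)

  phase : ℤ → ℤ → ℤ → ℤ → ℤ
  phase k m y x = (+ 2) ℤ.* k ℤ.* x ℤ.+ (y ℤ.- x) ℤ.* x ℤ.* m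

  phase-shift : ∀ k m y x →
    phase k m y (x ℤ.+ y) ≡ phase k m y x ℤ.+ (k ℤ.- m ℤ.* x) ℤ.* (+ 2 ℤ.* y)
  phase-shift = expanded
    where
    expanded : ∀ k m y x →
      + 2 ℤ.* k ℤ.* (x ℤ.+ y) ℤ.+ (y ℤ.- (x ℤ.+ y)) ℤ.* (x ℤ.+ y) ℤ.* m
        ≡ (+ 2 ℤ.* k ℤ.* x ℤ.+ (y ℤ.- x) ℤ.* x ℤ.* m) ℤ.+ (k ℤ.- m ℤ.* x) ℤ.* (+ 2 ℤ.* y)
    expanded = solve-∀

  phase-difference : ∀ k m y d b →
    phase k m y (d ℤ.+ b) ℤ.- phase k m y b ≡ phase k m y d ℤ.+ ℤ.- (+ 2 ℤ.* (m ℤ.* d)) ℤ.* b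
  phase-difference = expanded
    where
    expanded : ∀ k m y d b →
      (+ 2 ℤ.* k ℤ.* (d ℤ.+ b) ℤ.+ (y ℤ.- (d ℤ.+ b)) ℤ.* (d ℤ.+ b) ℤ.* m)
        ℤ.- (+ 2 ℤ.* k ℤ.* b ℤ.+ (y ℤ.- b) ℤ.* b ℤ.* m)
        ≡ (+ 2 ℤ.* k ℤ.* d ℤ.+ (y ℤ.- d) ℤ.* d ℤ.* m) ℤ.+ ℤ.- (+ 2 ℤ.* (m ℤ.* d)) ℤ.* b
    expanded = solve-∀

open Phase

module Cyclotomic {c ℓ} (R : CommutativeRing c ℓ) where
  open Cyclo R
  open import Algebra.Properties.Group +-group using (∙-cancelʳ; x∙y⁻¹≈ε⇒x≈y)
  open import Algebra.Properties.Ring ring using (-1*x≈-x)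
  open import Tactic.RingSolver.NonReflective (fromCommutativeRing R (λ _ → nothing))
    using (solve; _⊜_; _⊕_; _⊗_)
  open import Relation.Binary.Reasoning.Setoid setoid

  pow-cong : ∀ {x y} j → x ≈ y → pow x j ≈ pow y j
  pow-cong zero    x≈y = refl
  pow-cong (suc j) x≈y = *-cong x≈y (pow-cong j x≈y)

  pow-+ : ∀ x a b → pow x (a ℕ.+ b) ≈ pow x a * pow x b
  pow-+ x zero    b = sym (*-identityˡ _)
  pow-+ x (suc a) b = trans (*-congˡ (pow-+ x a b)) (sym (*-assoc _ _ _))

  sumTo-cong : ∀ j {f g : ℕ → Carrier} → (∀ l → f l ≈ g l) → sumTo j f ≈ sumTo j g
  sumTo-cong zero    f≈g = refl
  sumTo-cong (suc j) f≈g = +-cong (sumTo-cong j f≈g) (f≈g j)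

  sumTo-zero : ∀ j → sumTo j (λ _ → 0#) ≈ 0#
  sumTo-zero zero    = refl
  sumTo-zero (suc j) = trans (+-identityʳ _) (sumTo-zero j)

  sumTo-one : ∀ j → sumTo j (λ _ → 1#) ≈ nat j
  sumTo-one zero    = refl
  sumTo-one (suc j) = trans (+-comm _ _) (+-congˡ (sumTo-one j))

  sumTo-+ : ∀ j (f g : ℕ → Carrier) → sumTo j (λ l → f l + g l) ≈ sumTo j f + sumTo j g
  sumTo-+ zero    f g = sym (+-identityˡ _)
  sumTo-+ (suc j) f g = trans (+-congʳ (sumTo-+ j f g))
    (solve 4 (λ A B a b → ((A ⊕ B) ⊕ (a ⊕ b)) ⊜ ((A ⊕ a) ⊕ (B ⊕ b))) refl _ _ _ _)

  sumTo-*ˡ : ∀ j x (f : ℕ → Carrier) → x * sumTo j f ≈ sumTo j (λ l → x * f l)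
  sumTo-*ˡ zero    x f = zeroʳ x
  sumTo-*ˡ (suc j) x f = trans (distribˡ x _ _) (+-congʳ (sumTo-*ˡ j x f))

  sumTo-*ʳ : ∀ j x (f : ℕ → Carrier) → sumTo j f * x ≈ sumTo j (λ l → f l * x)
  sumTo-*ʳ j x f = trans (*-comm _ x) (trans (sumTo-*ˡ j x f) (sumTo-cong j (λ l → *-comm x (f l))))

  sumTo-swap : ∀ a b (h : ℕ → ℕ → Carrier) →
    sumTo a (λ x → sumTo b (h x)) ≈ sumTo b (λ y → sumTo a (λ x → h x y))
  sumTo-swap zero    b h = sym (sumTo-zero b)
  sumTo-swap (suc a) b h = trans (+-congʳ (sumTo-swap a b h)) (sym (sumTo-+ b _ _))

  sumTo-sucˡ : ∀ j (h : ℕ → Carrier) → sumTo (suc j) h ≈ h 0 + sumTo j (λ a → h (suc a))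
  sumTo-sucˡ zero    h = +-comm _ _
  sumTo-sucˡ (suc j) h = trans (+-congʳ (sumTo-sucˡ j h)) (+-assoc _ _ _)

  sumTo-rotate : ∀ j (h : ℕ → Carrier) → h j ≈ h 0 → sumTo j (λ a → h (suc a)) ≈ sumTo j h
  sumTo-rotate j h hj≈h0 = ∙-cancelʳ (h 0) _ _ (begin
    sumTo j (λ a → h (suc a)) + h 0 ≈⟨ +-comm _ _ ⟩
    h 0 + sumTo j (λ a → h (suc a)) ≈⟨ sumTo-sucˡ j h ⟨
    sumTo j h + h j                 ≈⟨ +-congˡ hj≈h0 ⟩
    sumTo j h + h 0                 ∎)

  sumTo-shift : ∀ j (g : ℕ → Carrier) → (∀ l → g (l ℕ.+ j) ≈ g l) →
    ∀ b → sumTo j (λ a → g (a ℕ.+ b)) ≈ sumTo j g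
  sumTo-shift j g periodic zero = sumTo-cong j (λ a → reflexive (P.cong g (ℕP.+-identityʳ a)))
  sumTo-shift j g periodic (suc b) = begin
    sumTo j (λ a → g (a ℕ.+ suc b))   ≈⟨ sumTo-cong j (λ a → reflexive (P.cong g (ℕP.+-suc a b))) ⟩
    sumTo j (λ a → g (suc a ℕ.+ b))   ≈⟨ sumTo-rotate j (λ a → g (a ℕ.+ b)) wraps ⟩
    sumTo j (λ a → g (a ℕ.+ b))       ≈⟨ sumTo-shift j g periodic b ⟩
    sumTo j g                         ∎
    where
    wraps : g (j ℕ.+ b) ≈ g (0 ℕ.+ b)
    wraps = trans (reflexive (P.cong g (ℕP.+-comm j b))) (periodic b)

  -- In a domain, Σ_{b<j} z^b = 0 when z^j = 1 but z ≠ 1: multiplying by z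
  -- rotates the sum, so (z - 1)·Σ = 0.
  geometric-sum-vanishes : NoZeroDivisors → ∀ j z → pow z j ≈ 1# → ¬ (z ≈ 1#) → sumTo j (pow z) ≈ 0#
  geometric-sum-vanishes nzd j z zʲ≈1 z≉1 with nzd (z + - 1#) Σ (begin
      (z + - 1#) * Σ   ≈⟨ distribʳ Σ z (- 1#) ⟩
      z * Σ + - 1# * Σ ≈⟨ +-cong zΣ≈Σ (-1*x≈-x Σ) ⟩
      Σ + - Σ          ≈⟨ -‿inverseʳ Σ ⟩
      0#               ∎)
    where
    Σ = sumTo j (pow z)
    zΣ≈Σ : z * Σ ≈ Σ
    zΣ≈Σ = trans (sumTo-*ˡ j z (pow z)) (sumTo-rotate j (pow z) zʲ≈1)
  ... | inj₁ z-1≈0 = ⊥-elim (z≉1 (x∙y⁻¹≈ε⇒x≈y z 1# z-1≈0))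
  ... | inj₂ Σ≈0   = Σ≈0

  module Conjugation {conj ω} (isc : IsConjugation conj ω) where
    open IsConjugation isc

    conj-0 : conj 0# ≈ 0#
    conj-0 = ∙-cancelʳ (conj 0#) _ _ (begin
      conj 0# + conj 0# ≈⟨ conj-+ 0# 0# ⟨
      conj (0# + 0#)    ≈⟨ conj-cong (+-identityʳ 0#) ⟩
      conj 0#           ≈⟨ +-identityˡ _ ⟨
      0# + conj 0#      ∎)

    conj-pow : ∀ x j → conj (pow x j) ≈ pow (conj x) j
    conj-pow x zero    = conj-1
    conj-pow x (suc j) = trans (conj-* _ _) (*-congˡ (conj-pow x j))

    conj-nat : ∀ j → conj (nat j) ≈ nat j
    conj-nat zero    = conj-0
    conj-nat (suc j) = trans (conj-+ _ _) (+-cong conj-1 (conj-nat j))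

    conj-sumTo : ∀ j f → conj (sumTo j f) ≈ sumTo j (λ l → conj (f l))
    conj-sumTo zero    f = conj-0
    conj-sumTo (suc j) f = trans (conj-+ _ _) (+-congʳ (conj-sumTo j f))

    conj-inverse : ∀ a b → conj a ≈ a → a * b ≈ 1# → conj b ≈ b
    conj-inverse a b conj-a≈a ab≈1 = begin
      conj b             ≈⟨ *-identityʳ _ ⟨
      conj b * 1#        ≈⟨ *-congˡ ab≈1 ⟨
      conj b * (a * b)   ≈⟨ *-assoc _ _ _ ⟨
      (conj b * a) * b   ≈⟨ *-congʳ conj-b*a≈1 ⟩
      1# * b             ≈⟨ *-identityˡ b ⟩
      b                  ∎
      where
      conj-b*a≈1 : conj b * a ≈ 1#
      conj-b*a≈1 = begin
        conj b * a       ≈⟨ *-congˡ conj-a≈a ⟨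
        conj b * conj a  ≈⟨ conj-* b a ⟨
        conj (b * a)     ≈⟨ conj-cong (trans (*-comm b a) ab≈1) ⟩
        conj 1#          ≈⟨ conj-1 ⟩
        1#               ∎

  module Character (N' : ℕ) (ω : Carrier) (ωᴺ≈1 : pow ω (suc N') ≈ 1#) where
    N : ℕ
    N = suc N'

    E : ℤ → Carrier
    E = zpow N ω

    pow-multiple : ∀ q → pow ω (q ℕ.* N) ≈ 1#
    pow-multiple zero    = refl
    pow-multiple (suc q) = trans (pow-+ ω N (q ℕ.* N)) (trans (*-cong ωᴺ≈1 (pow-multiple q)) (*-identityˡ 1#))

    E-pos : ∀ a → E (+ a) ≈ pow ω a
    E-pos a = sym (begin
      pow ω a                                   ≡⟨ P.cong (pow ω) (m≡m%n+[m/n]*n a N) ⟩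
      pow ω (a ℕ.% N ℕ.+ (a ℕ./ N) ℕ.* N)       ≈⟨ pow-+ ω (a ℕ.% N) ((a ℕ./ N) ℕ.* N) ⟩
      pow ω (a ℕ.% N) * pow ω ((a ℕ./ N) ℕ.* N) ≈⟨ *-congˡ (pow-multiple (a ℕ./ N)) ⟩
      pow ω (a ℕ.% N) * 1#                      ≈⟨ *-identityʳ _ ⟩
      pow ω (a ℕ.% N)                           ∎)

    E-resp : ∀ {e e'} → e P.≡ e' → E e ≈ E e'
    E-resp e≡e' = reflexive (P.cong E e≡e')

    E-periodic : ∀ e t → E (e ℤ.+ t ℤ.* + N) ≈ E e
    E-periodic e t = reflexive (P.cong (pow ω) (%ℕ-periodic N e t))

    E-multiple : ∀ t → E (t ℤ.* + N) ≈ 1#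
    E-multiple t = trans (E-resp (P.sym (ℤP.+-identityˡ (t ℤ.* + N)))) (trans (E-periodic (+ 0) t) (E-pos 0))

    E-+ : ∀ a b → E (a ℤ.+ b) ≈ E a * E b
    E-+ a b = begin
      E (a ℤ.+ b)                               ≈⟨ E-resp decomposition ⟩
      E (+ (ra ℕ.+ rb) ℤ.+ (qa ℤ.+ qb) ℤ.* + N) ≈⟨ E-periodic (+ (ra ℕ.+ rb)) (qa ℤ.+ qb) ⟩
      E (+ (ra ℕ.+ rb))                         ≈⟨ E-pos (ra ℕ.+ rb) ⟩
      pow ω (ra ℕ.+ rb)                         ≈⟨ pow-+ ω ra rb ⟩
      E a * E b                                 ∎
      where
      ra = a %ℕ N
      rb = b %ℕ N
      qa = a /ℕ N
      qb = b /ℕ N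
      regroup : ∀ x y u v D → (x ℤ.+ u ℤ.* D) ℤ.+ (y ℤ.+ v ℤ.* D) P.≡ (x ℤ.+ y) ℤ.+ (u ℤ.+ v) ℤ.* D
      regroup = solve-∀
      decomposition : a ℤ.+ b P.≡ + (ra ℕ.+ rb) ℤ.+ (qa ℤ.+ qb) ℤ.* + N
      decomposition = P.trans (P.cong₂ ℤ._+_ (a≡a%ℕn+[a/ℕn]*n a N) (a≡a%ℕn+[a/ℕn]*n b N))
        (P.trans (regroup (+ ra) (+ rb) qa qb (+ N))
                 (P.cong (ℤ._+ (qa ℤ.+ qb) ℤ.* + N) (P.sym (ℤP.pos-+ ra rb))))

    E-*pos : ∀ e b → E (e ℤ.* + b) ≈ pow (E e) b
    E-*pos e zero    = trans (E-resp (ℤP.*-zeroʳ e)) (E-pos 0)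
    E-*pos e (suc b) = begin
      E (e ℤ.* + suc b)       ≈⟨ E-resp (P.trans (P.cong (e ℤ.*_) (ℤP.pos-+ 1 b)) (unfold e (+ b))) ⟩
      E (e ℤ.+ e ℤ.* + b)     ≈⟨ E-+ e (e ℤ.* + b) ⟩
      E e * E (e ℤ.* + b)     ≈⟨ *-congˡ (E-*pos e b) ⟩
      E e * pow (E e) b       ∎
      where
      unfold : ∀ e x → e ℤ.* (+ 1 ℤ.+ x) P.≡ e ℤ.+ e ℤ.* x
      unfold = solve-∀

    conj-E : ∀ {conj} → IsConjugation conj ω → ∀ e → conj (E e) ≈ E (ℤ.- e)
    conj-E {conj} isc e = begin
      conj (pow ω r)         ≈⟨ conj-pow ω r ⟩
      pow (conj ω) r         ≈⟨ pow-cong r conj-ω≈E-1 ⟩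
      pow (E (ℤ.- + 1)) r    ≈⟨ E-*pos (ℤ.- + 1) r ⟨
      E (ℤ.- + 1 ℤ.* + r)    ≈⟨ E-periodic (ℤ.- + 1 ℤ.* + r) (ℤ.- (e /ℕ N)) ⟨
      E (ℤ.- + 1 ℤ.* + r ℤ.+ ℤ.- (e /ℕ N) ℤ.* + N) ≈⟨ E-resp negation ⟨
      E (ℤ.- e)              ∎
      where
      open IsConjugation isc
      open Conjugation isc
      r = e %ℕ N
      conj-ω≈E-1 : conj ω ≈ E (ℤ.- + 1)
      conj-ω≈E-1 = begin
        conj ω                        ≈⟨ *-identityʳ _ ⟨
        conj ω * 1#                   ≈⟨ *-congˡ (trans (E-resp (ℤP.+-inverseʳ (+ 1))) (E-pos 0)) ⟨
        conj ω * E (+ 1 ℤ.+ ℤ.- + 1)  ≈⟨ *-congˡ (trans (E-+ (+ 1) (ℤ.- + 1)) (*-congʳ (trans (E-pos 1) (*-identityʳ ω)))) ⟩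
        conj ω * (ω * E (ℤ.- + 1))    ≈⟨ *-assoc _ _ _ ⟨
        (conj ω * ω) * E (ℤ.- + 1)    ≈⟨ *-congʳ conj-ω ⟩
        1# * E (ℤ.- + 1)              ≈⟨ *-identityˡ _ ⟩
        E (ℤ.- + 1)                   ∎
      negate : ∀ x q D → ℤ.- (x ℤ.+ q ℤ.* D) P.≡ ℤ.- + 1 ℤ.* x ℤ.+ ℤ.- q ℤ.* D
      negate = solve-∀
      negation : ℤ.- e P.≡ ℤ.- + 1 ℤ.* + r ℤ.+ ℤ.- (e /ℕ N) ℤ.* + N
      negation = P.trans (P.cong ℤ.-_ (a≡a%ℕn+[a/ℕn]*n e N)) (negate (+ r) (e /ℕ N) (+ N))

    E≈1⇒%ℕ≡0 : IsPrimitiveRoot N ω → ∀ e → E e ≈ 1# → e %ℕ N P.≡ 0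
    E≈1⇒%ℕ≡0 prim e E≈1 with e %ℕ N in r≡
    ... | zero  = P.refl
    ... | suc j = ⊥-elim (proj₂ prim (suc j) (s≤s z≤n) (P.subst (ℕ._< N) r≡ (n%ℕd<d e N)) E≈1)

  module Orthogonality (nzd : NoZeroDivisors) (n' : ℕ) (ω : Carrier)
    (prim : IsPrimitiveRoot (2 ℕ.* suc n') ω) where
    n : ℕ
    n = suc n'

    open Character (ℕ.pred (2 ℕ.* n)) ω (proj₁ prim) public

    +N≡2n : + N P.≡ + 2 ℤ.* + n
    +N≡2n = ℤP.pos-* 2 n

    orthogonality : ∀ t → sumTo n (λ b → E (ℤ.- (+ 2 ℤ.* t) ℤ.* + b)) ≈ nat n * delta n t
    orthogonality t with t %ℕ n in t%n≡
    ... | zero = begin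
      sumTo n (λ b → E (ℤ.- (+ 2 ℤ.* t) ℤ.* + b)) ≈⟨ sumTo-cong n term≈1 ⟩
      sumTo n (λ _ → 1#)                          ≈⟨ sumTo-one n ⟩
      nat n                                       ≈⟨ *-identityʳ _ ⟨
      nat n * 1#                                  ∎
      where
      q = t /ℕ n
      reorder : ∀ q y b → ℤ.- (+ 2 ℤ.* (q ℤ.* y)) ℤ.* b P.≡ ℤ.- (q ℤ.* b) ℤ.* (+ 2 ℤ.* y)
      reorder = solve-∀
      term≈1 : ∀ b → E (ℤ.- (+ 2 ℤ.* t) ℤ.* + b) ≈ 1#
      term≈1 b = trans (E-resp exponent) (E-multiple (ℤ.- (q ℤ.* + b)))
        where
        exponent : ℤ.- (+ 2 ℤ.* t) ℤ.* + b P.≡ ℤ.- (q ℤ.* + b) ℤ.* + N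
        exponent = P.trans (P.cong (λ x → ℤ.- (+ 2 ℤ.* x) ℤ.* + b) (%ℕ≡0⇒multiple n t t%n≡))
                   (P.trans (reorder q (+ n) (+ b)) (P.cong (λ x → ℤ.- (q ℤ.* + b) ℤ.* x) (P.sym +N≡2n)))
    ... | suc r = begin
      sumTo n (λ b → E (z ℤ.* + b)) ≈⟨ sumTo-cong n (E-*pos z) ⟩
      sumTo n (pow (E z))           ≈⟨ geometric-sum-vanishes nzd n (E z) Eᶻⁿ≈1 Eᶻ≉1 ⟩
      0#                            ≈⟨ zeroʳ _ ⟨
      nat n * 0#                    ∎
      where
      z = ℤ.- (+ 2 ℤ.* t)
      reorder : ∀ t y → ℤ.- (+ 2 ℤ.* t) ℤ.* y P.≡ ℤ.- t ℤ.* (+ 2 ℤ.* y)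
      reorder = solve-∀
      Eᶻⁿ≈1 : pow (E z) n ≈ 1#
      Eᶻⁿ≈1 = trans (sym (E-*pos z n)) (trans (E-resp exponent) (E-multiple (ℤ.- t)))
        where
        exponent : z ℤ.* + n P.≡ ℤ.- t ℤ.* + N
        exponent = P.trans (reorder t (+ n)) (P.cong (λ x → ℤ.- t ℤ.* x) (P.sym +N≡2n))
      Eᶻ≉1 : ¬ (E z ≈ 1#)
      Eᶻ≉1 Eᶻ≈1 with P.trans (P.sym t%n≡) (half-multiple n t (E≈1⇒%ℕ≡0 prim z Eᶻ≈1))
      ... | ()

  module SquaredModulus (nzd : NoZeroDivisors) (ω : Carrier) (conj : Carrier → Carrier)
    (invn : Carrier) (k m : ℤ) (n' : ℕ) (prim : IsPrimitiveRoot (2 ℕ.* suc n') ω)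
    (isc : IsConjugation conj ω) (n*invn≈1 : nat (suc n') * invn ≈ 1#) where
    open Orthogonality nzd n' ω prim
    open Conjugation isc

    F : ℕ → ℤ
    F l = phase k m (+ n) (+ l)

    g : ℕ → Carrier
    g l = summand n ω k m l

    S T : Carrier
    S = sumTo n g
    T = sumTo n (λ d → g d * delta n (m ℤ.* + d))

    g-periodic : ∀ l → g (l ℕ.+ n) ≈ g l
    g-periodic l = trans (E-resp exponent) (E-periodic (F l) (k ℤ.- m ℤ.* + l))
      where
      exponent : F (l ℕ.+ n) P.≡ F l ℤ.+ (k ℤ.- m ℤ.* + l) ℤ.* + N
      exponent = P.trans (P.cong (phase k m (+ n)) (ℤP.pos-+ l n))
        (P.trans (phase-shift k m (+ n) (+ l))
                 (P.cong (λ x → F l ℤ.+ (k ℤ.- m ℤ.* + l) ℤ.* x) (P.sym +N≡2n)))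

    g-cross : ∀ b d → g (d ℕ.+ b) * E (ℤ.- F b) ≈ g d * E (ℤ.- (+ 2 ℤ.* (m ℤ.* + d)) ℤ.* + b)
    g-cross b d = trans (sym (E-+ (F (d ℕ.+ b)) (ℤ.- F b)))
                        (trans (E-resp exponent) (E-+ (F d) _))
      where
      exponent : F (d ℕ.+ b) ℤ.- F b P.≡ F d ℤ.+ ℤ.- (+ 2 ℤ.* (m ℤ.* + d)) ℤ.* + b
      exponent = P.trans (P.cong (λ x → phase k m (+ n) x ℤ.- F b) (ℤP.pos-+ d b))
                         (phase-difference k m (+ n) (+ d) (+ b))

    conj-S : conj S ≈ sumTo n (λ b → E (ℤ.- F b))
    conj-S = trans (conj-sumTo n g) (sumTo-cong n (λ b → conj-E isc (F b)))

    S·conjS≈n·T : S * conj S ≈ nat n * T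
    S·conjS≈n·T = begin
      S * conj S                                              ≈⟨ *-congˡ conj-S ⟩
      S * sumTo n (λ b → E (ℤ.- F b))                         ≈⟨ sumTo-*ˡ n S _ ⟩
      sumTo n (λ b → S * E (ℤ.- F b))                         ≈⟨ sumTo-cong n shifted ⟩
      sumTo n (λ b → sumTo n (λ d → g d * W d b))             ≈⟨ sumTo-swap n n (λ b d → g d * W d b) ⟩
      sumTo n (λ d → sumTo n (λ b → g d * W d b))             ≈⟨ sumTo-cong n inner ⟩
      sumTo n (λ d → nat n * (g d * delta n (m ℤ.* + d)))     ≈⟨ sumTo-*ˡ n (nat n) _ ⟨
      nat n * T                                               ∎
      where
      W : ℕ → ℕ → Carrier
      W d b = E (ℤ.- (+ 2 ℤ.* (m ℤ.* + d)) ℤ.* + b)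
      shifted : ∀ b → S * E (ℤ.- F b) ≈ sumTo n (λ d → g d * W d b)
      shifted b = begin
        S * E (ℤ.- F b)                                 ≈⟨ *-congʳ (sumTo-shift n g g-periodic b) ⟨
        sumTo n (λ d → g (d ℕ.+ b)) * E (ℤ.- F b)       ≈⟨ sumTo-*ʳ n _ _ ⟩
        sumTo n (λ d → g (d ℕ.+ b) * E (ℤ.- F b))       ≈⟨ sumTo-cong n (g-cross b) ⟩
        sumTo n (λ d → g d * W d b)                     ∎
      inner : ∀ d → sumTo n (λ b → g d * W d b) ≈ nat n * (g d * delta n (m ℤ.* + d))
      inner d = begin
        sumTo n (λ b → g d * W d b)             ≈⟨ sumTo-*ˡ n (g d) _ ⟨
        g d * sumTo n (W d)                     ≈⟨ *-congˡ (orthogonality (m ℤ.* + d)) ⟩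
        g d * (nat n * delta n (m ℤ.* + d))     ≈⟨ solve 3 (λ a b c → (a ⊗ (b ⊗ c)) ⊜ (b ⊗ (a ⊗ c))) refl _ _ _ ⟩
        nat n * (g d * delta n (m ℤ.* + d))     ∎

    theorem : absSq conj (invn * S) ≈ invn * T
    theorem = begin
      (invn * S) * conj (invn * S)       ≈⟨ *-congˡ (trans (conj-* invn S) (*-congʳ conj-invn)) ⟩
      (invn * S) * (invn * conj S)       ≈⟨ *-assoc invn S _ ⟩
      invn * (S * (invn * conj S))       ≈⟨ *-congˡ (solve 3 (λ s i c → (s ⊗ (i ⊗ c)) ⊜ (i ⊗ (s ⊗ c))) refl S invn (conj S)) ⟩
      invn * (invn * (S * conj S))       ≈⟨ *-congˡ (*-congˡ S·conjS≈n·T) ⟩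
      invn * (invn * (nat n * T))        ≈⟨ *-congˡ (*-assoc _ _ _) ⟨
      invn * ((invn * nat n) * T)        ≈⟨ *-congˡ (*-congʳ (trans (*-comm _ _) n*invn≈1)) ⟩
      invn * (1# * T)                    ≈⟨ *-congˡ (*-identityˡ T) ⟩
      invn * T                           ∎
      where
      open IsConjugation isc using (conj-*)
      conj-invn : conj invn ≈ invn
      conj-invn = conj-inverse (nat n) invn (conj-nat n) n*invn≈1

corollary6 : ∀ {c ℓ} (R : CommutativeRing c ℓ) → let open Cyclo R in
    NoZeroDivisors →
    (ω : Carrier) → (conj : Carrier → Carrier) → (invn : Carrier) →
    (k m : ℤ) → (n : ℕ) → 1 ≤ n →
    IsPrimitiveRoot (2 ℕ.* n) ω → IsConjugation conj ω → nat n * invn ≈ 1# →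
    absSq conj (invn * sumTo n (λ l → summand n ω k m l))
    ≈ invn * sumTo n (λ l → summand n ω k m l * delta n (m ℤ.* (+ l)))
corollary6 R nzd ω conj invn k m (suc n') _ prim isc n*invn≈1 =
  Cyclotomic.SquaredModulus.theorem R nzd ω conj invn k m n' prim isc n*invn≈1
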